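{- Let $r,J,K$ be positive integers and let $c_{js},d_{ks}\in\mathbb{Z}_{\ge 0}$ for $1\le j\le J$, $1\le k\le K$, $1\le s\le r$. Put $C_j(p)=\sum_{s=1}^r c_{js}p_s$ and $D_k(p)=\sum_{s=1}^r d_{ks}p_s$. Assume: no $C_j$ and no $D_k$ is identically zero; $C_j\neq D_k$ for all $j,k$; for each $s$ some $c_{js}\neq 0$ or some $d_{ks}\neq 0$; and $\sum_{j=1}^J c_{js}=\sum_{k=1}^K d_{ks}$ for $s=1,\dots,r$. Let $n=r+J+K$, $N=n+r$, let $\mathbf{a}_1,\dots,\mathbf{a}_n$ be the standard unit basis vectors of $\mathbb{R}^n$, and for $s=1,\dots,r$ let $\mathbf{a}_{n+s}=(e_s,c_{1s},\dots,c_{Js},-d_{1s},\dots,-d_{Ks})$, where $e_s\in\mathbb{R}^r$ is the $s$-th standard unit vector. Let $A=\{\mathbf{a}_1,\dots,\mathbf{a}_N\}$, let $\Delta(A)$ be the convex hull of $A\cup\{\mathbf{0}\}$ and $z\Delta(A)=\{zu:u\in\Delta(A)\}$. Let $L=\{l\in\mathbb{Z}^N:\sum_{i=1}^N l_i\mathbf{a}_i=\mathbf{0}\}$ and $v^{(0)}=(-1,\dots,-1,0,\dots,0)\in\mathbb{C}^N$ ($r+J$ entries $-1$, then $K+r$ zeros). If $\sum_{i=1}^{J+r}\mathbf{a}_i$ is the unique interior lattice point of $(J+r+1)\Delta(A)$, then $v^{(0)}$ has minimal $\hat{\imath}$-negative support for each $i=n+1,\dots,n+r$.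
   Context: For $v=(v_1,\dots,v_N)\in\mathbb{C}^N$ and $i\in\{1,\dots,N\}$, the $\hat{\imath}$-negative support of $v$ is $\hat{\imath}\text{ -nsupp}(v)=\{j\in\{1,\dots,N\}\setminus\{i\}: v_j\text{ is a negative integer}\}$. One says $v$ has minimal $\hat{\imath}$-negative support if there is no $l\in L$ for which $\hat{\imath}\text{ -nsupp}(v+l)$ is a proper subset of $\hat{\imath}\text{ -nsupp}(v)$. "Interior lattice point" means a point of $\mathbb{Z}^n$ in the topological interior in $\mathbb{R}^n$.
   Formalization: The polytope $\Delta(A)$, its dilates $z\Delta(A)$ and the notion of interior lattice point are taken in ℚ^n, with rational convex coefficients and rational balls, instead of ℝ^n. -}

module Defs where

open import Data.Nat as ℕ using (ℕ; zero; suc)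
open import Data.Integer as ℤ using (ℤ; +_)
open import Data.Rational as ℚ using (ℚ; 0ℚ; 1ℚ)
open import Data.Fin using (Fin; zero; suc; toℕ; splitAt; _↑ʳ_)
open import Data.Fin.Properties using (_≟_)
open import Data.Sum using (_⊎_; inj₁; inj₂)
open import Data.Product using (Σ; ∃; _×_; _,_)
open import Relation.Nullary using (¬_; yes; no)
open import Relation.Binary.PropositionalEquality using (_≡_; _≢_)

∑ℕ : ∀ {m} → (Fin m → ℕ) → ℕ
∑ℕ {zero}  f = 0
∑ℕ {suc m} f = f zero ℕ.+ ∑ℕ (λ i → f (suc i))

∑ℤ : ∀ {m} → (Fin m → ℤ) → ℤ
∑ℤ {zero}  f = + 0
∑ℤ {suc m} f = f zero ℤ.+ ∑ℤ (λ i → f (suc i))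

∑ℚ : ∀ {m} → (Fin m → ℚ) → ℚ
∑ℚ {zero}  f = 0ℚ
∑ℚ {suc m} f = f zero ℚ.+ ∑ℚ (λ i → f (suc i))

δ : ∀ {m} → Fin m → Fin m → ℤ
δ k t with k ≟ t
... | yes _ = + 1
... | no  _ = + 0

-- ambient dimension n = r + J + K  (coordinates: first r, then J, then K)
dim : ℕ → ℕ → ℕ → ℕ
dim r J K = r ℕ.+ J ℕ.+ K

numPts : ℕ → ℕ → ℕ → ℕ
numPts r J K = dim r J K ℕ.+ r

-- the vector a_{n+s} = (e_s, c_{1s},…,c_{Js}, -d_{1s},…,-d_{Ks}), coordinate t
extraVec : ∀ {r J K} → (Fin J → Fin r → ℕ) → (Fin K → Fin r → ℕ) →
           Fin r → Fin (dim r J K) → ℤ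
extraVec {r} {J} {K} c d s t with splitAt (r ℕ.+ J) t
... | inj₂ k = ℤ.- (+ d k s)
... | inj₁ t' with splitAt r t'
...   | inj₁ s' = δ s s'
...   | inj₂ j  = + c j s

𝐚 : ∀ {r J K} → (Fin J → Fin r → ℕ) → (Fin K → Fin r → ℕ) →
    Fin (numPts r J K) → Fin (dim r J K) → ℤ
𝐚 {r} {J} {K} c d i with splitAt (dim r J K) i
... | inj₁ k = δ k
... | inj₂ s = extraVec c d s

InL : ∀ {r J K} → (Fin J → Fin r → ℕ) → (Fin K → Fin r → ℕ) →
      (Fin (numPts r J K) → ℤ) → Set
InL c d l = ∀ t → ∑ℤ (λ i → l i ℤ.* 𝐚 c d i t) ≡ + 0

toℚ : ℤ → ℚ
toℚ z = z ℚ./ 1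

InConvHull : ∀ {m n} → (Fin m → Fin n → ℚ) → (Fin n → ℚ) → Set
InConvHull {m} {n} p u =
  Σ (Fin m → ℚ) λ λ' →
    (∀ i → 0ℚ ℚ.≤ λ' i) × (∑ℚ λ' ≡ 1ℚ) ×
    (∀ t → u t ≡ ∑ℚ (λ i → λ' i ℚ.* p i t))

pointsWith0 : ∀ {r J K} → (Fin J → Fin r → ℕ) → (Fin K → Fin r → ℕ) →
              Fin (suc (numPts r J K)) → Fin (dim r J K) → ℚ
pointsWith0 c d zero    t = 0ℚ
pointsWith0 c d (suc i) t = toℚ (𝐚 c d i t)

InΔ : ∀ {r J K} → (Fin J → Fin r → ℕ) → (Fin K → Fin r → ℕ) →
      (Fin (dim r J K) → ℚ) → Set
InΔ c d u = InConvHull (pointsWith0 c d) u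

InScaledΔ : ∀ {r J K} → (Fin J → Fin r → ℕ) → (Fin K → Fin r → ℕ) →
            ℚ → (Fin (dim r J K) → ℚ) → Set
InScaledΔ c d z x = Σ (Fin _ → ℚ) λ u → InΔ c d u × (∀ t → x t ≡ z ℚ.* u t)

IsInteriorPt : ∀ {n} → ((Fin n → ℚ) → Set) → (Fin n → ℚ) → Set
IsInteriorPt {n} S p =
  Σ ℚ λ ε → (0ℚ ℚ.< ε) ×
    (∀ (q : Fin n → ℚ) → (∀ t → ℚ.∣ q t ℚ.- p t ∣ ℚ.< ε) → S q)

IsInteriorLatticePt : ∀ {n} → ((Fin n → ℚ) → Set) → (Fin n → ℤ) → Set
IsInteriorLatticePt S x = IsInteriorPt S (λ t → toℚ (x t))

IsUniqueInteriorLatticePt : ∀ {n} → ((Fin n → ℚ) → Set) → (Fin n → ℤ) → Set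
IsUniqueInteriorLatticePt {n} S x =
  IsInteriorLatticePt S x ×
  (∀ (y : Fin n → ℤ) → IsInteriorLatticePt S y → ∀ t → y t ≡ x t)

sumFirstPts : ∀ {r J K} → (Fin J → Fin r → ℕ) → (Fin K → Fin r → ℕ) →
              Fin (dim r J K) → ℤ
sumFirstPts {r} {J} c d t =
  ∑ℤ (λ i → if< (toℕ i) (J ℕ.+ r) (𝐚 c d i t))
  where
  if< : ℕ → ℕ → ℤ → ℤ
  if< a b z with a ℕ.<? b
  ... | yes _ = z
  ... | no  _ = + 0

v0 : ∀ {r J K} → Fin (numPts r J K) → ℤ
v0 {r} {J} i with toℕ i ℕ.<? r ℕ.+ J
... | yes _ = ℤ.-[1+ 0 ]
... | no  _ = + 0

-- j ∈ î-nsupp(v)   (entries are integers, so "negative integer" = "< 0")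
InNSupp : ∀ {N} → Fin N → (Fin N → ℤ) → Fin N → Set
InNSupp i v j = (j ≢ i) × (v j ℤ.< + 0)

MinimalNSupp : ∀ {r J K} → (Fin J → Fin r → ℕ) → (Fin K → Fin r → ℕ) →
               Fin (numPts r J K) → (Fin (numPts r J K) → ℤ) → Set
MinimalNSupp c d i v =
  ¬ (Σ (Fin _ → ℤ) λ l → InL c d l ×
       (∀ j → InNSupp i (λ k → v k ℤ.+ l k) j → InNSupp i v j) ×
       (∃ λ j → InNSupp i v j × ¬ InNSupp i (λ k → v k ℤ.+ l k) j))

{-# OPTIONS --safe #-}
module Submission where

-- Let l ∈ L shrink the î-negative support of v⁽⁰⁾, i = n + s. Then l ≥ 0 off the first r + J indices
-- (except at i) and l ≥ 1 at one of them. The a_{n+s′} have nonnegative entries in the first r + J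
-- coordinates, so the lattice relations there force l_{n+s} < 0, and the relation in coordinate s gives
-- l_s = −l_{n+s} ≥ 1.
-- A lattice point ∑ Wᵢ aᵢ with ∑ W ≤ Z is interior in (Z + 1)Δ(A) when W + εl′ is positive on the unit
-- vectors and nonnegative on the a_{n+s} for some l′ ∈ L and all small ε > 0: its neighbours are then
-- nonnegative combinations of total weight ≤ Z + 1. With b = ∑ₛ (e_{n+s} − a_{n+s}) ∈ L, positive on the
-- last K units because no D_k vanishes, both x = ∑_{i ≤ r+J} aᵢ (with l′ = b) and y = x + a_{n+s} − a_s
-- (with l′ = 2l + b) are interior lattice points of (J + r + 1)Δ(A). Uniqueness gives a_{n+s} = e_s, so
-- column s of c and d vanishes, which is excluded.

open import Defs
open import Algebra.Bundles using (CommutativeRing)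
open import Data.Nat as ℕ using (ℕ; zero; suc)
import Data.Nat.Properties as ℕP
import Data.Nat.Tactic.RingSolver as ℕSolver
open import Data.Integer as ℤ using (ℤ; +_; -[1+_]; ∣_∣)
import Data.Integer.Properties as ℤP
open import Data.Integer.Tactic.RingSolver using (solve-∀)
open import Data.Rational.Solver using (module +-*-Solver)
open import Data.Rational as ℚ using (ℚ; 0ℚ; 1ℚ; _/_)
import Data.Rational.Properties as ℚP
open import Data.Rational.Unnormalised as ℚᵘ using (mkℚᵘ; *≡*; *≤*)
import Data.Rational.Unnormalised.Properties as ℚᵘP
open import Data.Fin using (Fin; zero; suc; toℕ; splitAt; _↑ˡ_; _↑ʳ_)
open import Data.Fin.Properties
  using (toℕ-↑ˡ; toℕ-↑ʳ; toℕ<n; ↑ˡ-injective; ↑ʳ-injective; splitAt-↑ˡ; splitAt-↑ʳ; suc-injective; ¬∀⟶∃¬)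
  renaming (_≟_ to _≟ᶠ_)
open import Data.Sum using (_⊎_; inj₁; inj₂; [_,_]′)
open import Data.Product using (∃; _×_; _,_; proj₁; proj₂)
open import Data.Empty using (⊥-elim)
open import Function using (_∘_)
open import Relation.Nullary using (¬_; Dec; yes; no)
open import Relation.Binary.PropositionalEquality
  using (_≡_; _≢_; refl; sym; trans; cong; cong₂; subst; subst₂; module ≡-Reasoning)

data Split (m n : ℕ) : Fin (m ℕ.+ n) → Set where
  left  : (i : Fin m) → Split m n (i ↑ˡ n)
  right : (j : Fin n) → Split m n (m ↑ʳ j)

split : ∀ m {n} (i : Fin (m ℕ.+ n)) → Split m n i
split zero    j       = right j
split (suc m) zero    = left zero
split (suc m) (suc i) with split m i
... | left  u = left (suc u)
... | right j = right j

↑ˡ≢↑ʳ : ∀ {m n} (i : Fin m) (j : Fin n) → i ↑ˡ n ≢ m ↑ʳ j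
↑ˡ≢↑ʳ {m} {n} i j eq = ℕP.<⇒≱ (toℕ<n i) (begin
  m               ≤⟨ ℕP.m≤m+n m (toℕ j) ⟩
  m ℕ.+ toℕ j     ≡⟨ toℕ-↑ʳ m j ⟨
  toℕ (m ↑ʳ j)    ≡⟨ cong toℕ eq ⟨
  toℕ (i ↑ˡ n)    ≡⟨ toℕ-↑ˡ i n ⟩
  toℕ i           ∎)
  where open ℕP.≤-Reasoning

δ-refl : ∀ {m} (t : Fin m) → δ t t ≡ + 1
δ-refl t with t ≟ᶠ t
... | yes _  = refl
... | no t≢t = ⊥-elim (t≢t refl)

δ-≢ : ∀ {m} {u t : Fin m} → u ≢ t → δ u t ≡ + 0
δ-≢ {u = u} {t} u≢t with u ≟ᶠ t
... | yes u≡t = ⊥-elim (u≢t u≡t)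
... | no  _   = refl

δ-suc : ∀ {m} (u t : Fin m) → δ (suc u) (suc t) ≡ δ u t
δ-suc u t = from (u ≟ᶠ t)
  where
  from : Dec (u ≡ t) → δ (suc u) (suc t) ≡ δ u t
  from (yes refl) = trans (δ-refl (suc u)) (sym (δ-refl u))
  from (no  u≢t)  = trans (δ-≢ (u≢t ∘ suc-injective)) (sym (δ-≢ u≢t))

δ-nonNeg : ∀ {m} (u t : Fin m) → + 0 ℤ.≤ δ u t
δ-nonNeg u t with u ≟ᶠ t
... | yes _ = ℤ.+≤+ ℕ.z≤n
... | no  _ = ℤ.+≤+ ℕ.z≤n

-- unit u is a_u and extra s is a_{n+s}; among the units, front t are the first r + J indices (where
-- v⁽⁰⁾ = −1) and back k the last K.
module Configuration {r J K : ℕ} (c : Fin J → Fin r → ℕ) (d : Fin K → Fin r → ℕ) where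

  n N : ℕ
  n = dim r J K
  N = numPts r J K

  unit : Fin n → Fin N
  unit u = u ↑ˡ r

  extra : Fin r → Fin N
  extra s = n ↑ʳ s

  front : Fin (r ℕ.+ J) → Fin N
  front t = unit (t ↑ˡ K)

  back : Fin K → Fin N
  back k = unit ((r ℕ.+ J) ↑ʳ k)

  combination : (Fin N → ℤ) → Fin n → ℤ
  combination W t = ∑ℤ (λ i → W i ℤ.* 𝐚 c d i t)

  sCoord : Fin r → Fin n
  sCoord s = (s ↑ˡ J) ↑ˡ K

  jCoord : Fin J → Fin n
  jCoord j = (r ↑ʳ j) ↑ˡ K

  kCoord : Fin K → Fin n
  kCoord k = (r ℕ.+ J) ↑ʳ k

  𝐚-unit : ∀ u t → 𝐚 c d (unit u) t ≡ δ u t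
  𝐚-unit u t rewrite splitAt-↑ˡ n u r = refl

  𝐚-extra : ∀ s t → 𝐚 c d (extra s) t ≡ extraVec c d s t
  𝐚-extra s t rewrite splitAt-↑ʳ n r s = refl

  extraVec-s : ∀ s s′ → extraVec c d s (sCoord s′) ≡ δ s s′
  extraVec-s s s′ rewrite splitAt-↑ˡ (r ℕ.+ J) (s′ ↑ˡ J) K | splitAt-↑ˡ r s′ J = refl

  extraVec-j : ∀ s j → extraVec c d s (jCoord j) ≡ + c j s
  extraVec-j s j rewrite splitAt-↑ˡ (r ℕ.+ J) (r ↑ʳ j) K | splitAt-↑ʳ r J j = refl

  extraVec-k : ∀ s k → extraVec c d s (kCoord k) ≡ ℤ.- (+ d k s)
  extraVec-k s k rewrite splitAt-↑ʳ (r ℕ.+ J) K k = refl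

  extraVec-front-nonNeg : ∀ s (t : Fin (r ℕ.+ J)) → + 0 ℤ.≤ extraVec c d s (t ↑ˡ K)
  extraVec-front-nonNeg s t with split r t
  ... | left  s′ = subst (+ 0 ℤ.≤_) (sym (extraVec-s s s′)) (δ-nonNeg s s′)
  ... | right j  = subst (+ 0 ℤ.≤_) (sym (extraVec-j s j)) (ℤ.+≤+ ℕ.z≤n)

  v0-front : ∀ t → v0 {r} {J} {K} (front t) ≡ -[1+ 0 ]
  v0-front t with toℕ (front t) ℕ.<? r ℕ.+ J
  ... | yes _ = refl
  ... | no ≮ = ⊥-elim (≮ (subst (ℕ._< r ℕ.+ J) (sym (trans (toℕ-↑ˡ (t ↑ˡ K) r) (toℕ-↑ˡ t K))) (toℕ<n t)))

  v0-≥ : ∀ i → r ℕ.+ J ℕ.≤ toℕ i → v0 {r} {J} {K} i ≡ + 0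
  v0-≥ i ≥ with toℕ i ℕ.<? r ℕ.+ J
  ... | yes < = ⊥-elim (ℕP.<⇒≱ < ≥)
  ... | no  _ = refl

  v0-back : ∀ k → v0 {r} {J} {K} (back k) ≡ + 0
  v0-back k = v0-≥ (back k) (begin
    r ℕ.+ J                       ≤⟨ ℕP.m≤m+n (r ℕ.+ J) (toℕ k) ⟩
    r ℕ.+ J ℕ.+ toℕ k             ≡⟨ toℕ-↑ʳ (r ℕ.+ J) k ⟨
    toℕ (kCoord k)                ≡⟨ toℕ-↑ˡ (kCoord k) r ⟨
    toℕ (back k)                  ∎)
    where open ℕP.≤-Reasoning

  v0-extra : ∀ s → v0 {r} {J} {K} (extra s) ≡ + 0
  v0-extra s = v0-≥ (extra s) (begin
    r ℕ.+ J                       ≤⟨ ℕP.m≤m+n (r ℕ.+ J) K ⟩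
    n                             ≤⟨ ℕP.m≤m+n n (toℕ s) ⟩
    n ℕ.+ toℕ s                   ≡⟨ toℕ-↑ʳ n s ⟨
    toℕ (extra s)                 ∎)
    where open ℕP.≤-Reasoning

module Sums {c ℓ} (R : CommutativeRing c ℓ) where

  open CommutativeRing R hiding (zero) renaming (sym to ≈-sym; trans to ≈-trans)
  open import Relation.Binary.Reasoning.Setoid setoid
  open import Algebra.Properties.AbelianGroup +-abelianGroup using (⁻¹-∙-comm; ε⁻¹≈ε)
  open import Algebra.Properties.CommutativeSemigroup +-commutativeSemigroup using (interchange)

  module Properties
    (∑ : ∀ {m} → (Fin m → Carrier) → Carrier)
    (∑-zero : (f : Fin 0 → Carrier) → ∑ f ≈ 0#)
    (∑-suc : ∀ {m} (f : Fin (suc m) → Carrier) → ∑ f ≈ f zero + ∑ (f ∘ suc))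
    (ι : ℤ → Carrier) (ι-0 : ι (+ 0) ≈ 0#) (ι-1 : ι (+ 1) ≈ 1#) (ι-+ : ∀ x y → ι (x ℤ.+ y) ≈ ι x + ι y)
    where

    ∑-cong : ∀ {m} {f g : Fin m → Carrier} → (∀ i → f i ≈ g i) → ∑ f ≈ ∑ g
    ∑-cong {zero}  {f} {g} _   = ≈-trans (∑-zero f) (≈-sym (∑-zero g))
    ∑-cong {suc m} {f} {g} f≈g = begin
      ∑ f                    ≈⟨ ∑-suc f ⟩
      f zero + ∑ (f ∘ suc)   ≈⟨ +-cong (f≈g zero) (∑-cong (f≈g ∘ suc)) ⟩
      g zero + ∑ (g ∘ suc)   ≈⟨ ∑-suc g ⟨
      ∑ g                    ∎

    ∑-zeros : ∀ {m} → ∑ {m} (λ _ → 0#) ≈ 0#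
    ∑-zeros {zero}  = ∑-zero _
    ∑-zeros {suc m} = ≈-trans (∑-suc _) (≈-trans (+-congˡ (∑-zeros {m})) (+-identityʳ 0#))

    ∑-distrib-+ : ∀ {m} (f g : Fin m → Carrier) → ∑ (λ i → f i + g i) ≈ ∑ f + ∑ g
    ∑-distrib-+ {zero}  f g = ≈-trans (∑-zero _) (≈-sym (≈-trans (+-cong (∑-zero f) (∑-zero g)) (+-identityʳ 0#)))
    ∑-distrib-+ {suc m} f g = begin
      ∑ (λ i → f i + g i)                                ≈⟨ ∑-suc _ ⟩
      (f zero + g zero) + ∑ (λ i → f (suc i) + g (suc i)) ≈⟨ +-congˡ (∑-distrib-+ (f ∘ suc) (g ∘ suc)) ⟩
      (f zero + g zero) + (∑ (f ∘ suc) + ∑ (g ∘ suc))    ≈⟨ interchange _ _ _ _ ⟩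
      (f zero + ∑ (f ∘ suc)) + (g zero + ∑ (g ∘ suc))    ≈⟨ +-cong (∑-suc f) (∑-suc g) ⟨
      ∑ f + ∑ g                                          ∎

    *-distribˡ-∑ : ∀ {m} x (f : Fin m → Carrier) → x * ∑ f ≈ ∑ (λ i → x * f i)
    *-distribˡ-∑ {zero}  x f = ≈-trans (*-congˡ (∑-zero f)) (≈-trans (zeroʳ x) (≈-sym (∑-zero _)))
    *-distribˡ-∑ {suc m} x f = begin
      x * ∑ f                          ≈⟨ *-congˡ (∑-suc f) ⟩
      x * (f zero + ∑ (f ∘ suc))       ≈⟨ distribˡ x _ _ ⟩
      x * f zero + x * ∑ (f ∘ suc)     ≈⟨ +-congˡ (*-distribˡ-∑ x (f ∘ suc)) ⟩
      x * f zero + ∑ (λ i → x * f (suc i)) ≈⟨ ∑-suc _ ⟨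
      ∑ (λ i → x * f i)                ∎

    *-distribʳ-∑ : ∀ {m} x (f : Fin m → Carrier) → ∑ f * x ≈ ∑ (λ i → f i * x)
    *-distribʳ-∑ x f = ≈-trans (*-comm (∑ f) x) (≈-trans (*-distribˡ-∑ x f) (∑-cong (λ i → *-comm x (f i))))

    neg-distrib-∑ : ∀ {m} (f : Fin m → Carrier) → - ∑ f ≈ ∑ (λ i → - f i)
    neg-distrib-∑ {zero}  f = ≈-trans (-‿cong (∑-zero f)) (≈-trans ε⁻¹≈ε (≈-sym (∑-zero _)))
    neg-distrib-∑ {suc m} f = begin
      - ∑ f                          ≈⟨ -‿cong (∑-suc f) ⟩
      - (f zero + ∑ (f ∘ suc))       ≈⟨ ⁻¹-∙-comm _ _ ⟨
      - f zero + - ∑ (f ∘ suc)       ≈⟨ +-congˡ (neg-distrib-∑ (f ∘ suc)) ⟩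
      - f zero + ∑ (λ i → - f (suc i)) ≈⟨ ∑-suc _ ⟨
      ∑ (λ i → - f i)                ∎

    ∑-splitAt : ∀ m {k} (f : Fin (m ℕ.+ k) → Carrier) →
                ∑ f ≈ ∑ (λ i → f (i ↑ˡ k)) + ∑ (λ j → f (m ↑ʳ j))
    ∑-splitAt zero    f = ≈-sym (≈-trans (+-congʳ (∑-zero _)) (+-identityˡ _))
    ∑-splitAt (suc m) f = begin
      ∑ f                                                            ≈⟨ ∑-suc f ⟩
      f zero + ∑ (f ∘ suc)                                           ≈⟨ +-congˡ (∑-splitAt m (f ∘ suc)) ⟩
      f zero + (∑ (λ i → f (suc (i ↑ˡ _))) + ∑ (λ j → f (suc m ↑ʳ j))) ≈⟨ +-assoc _ _ _ ⟨
      (f zero + ∑ (λ i → f (suc (i ↑ˡ _)))) + ∑ (λ j → f (suc m ↑ʳ j)) ≈⟨ +-congʳ (∑-suc _) ⟨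
      ∑ (λ i → f (i ↑ˡ _)) + ∑ (λ j → f (suc m ↑ʳ j))                 ∎

    ∑-const : ∀ {m} x → ∑ {m} (λ _ → x) ≈ ι (+ m) * x
    ∑-const {zero}  x = ≈-trans (∑-zero _) (≈-sym (≈-trans (*-congʳ ι-0) (zeroˡ x)))
    ∑-const {suc m} x = begin
      ∑ (λ _ → x)                 ≈⟨ ∑-suc _ ⟩
      x + ∑ (λ _ → x)             ≈⟨ +-cong (≈-sym (*-identityˡ x)) (∑-const x) ⟩
      1# * x + ι (+ m) * x        ≈⟨ distribʳ x 1# (ι (+ m)) ⟨
      (1# + ι (+ m)) * x          ≈⟨ *-congʳ (+-congʳ ι-1) ⟨
      (ι (+ 1) + ι (+ m)) * x     ≈⟨ *-congʳ (ι-+ (+ 1) (+ m)) ⟨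
      ι (+ suc m) * x             ∎

    private
      δ-vanishes : ∀ x {m} (u t : Fin m) → u ≢ t → x * ι (δ u t) ≈ 0#
      δ-vanishes x u t u≢t = ≈-trans (*-congˡ (≈-trans (reflexive (cong ι (δ-≢ u≢t))) ι-0)) (zeroʳ x)

      δ-picks : ∀ x {m} (t : Fin m) → x * ι (δ t t) ≈ x
      δ-picks x t = ≈-trans (*-congˡ (≈-trans (reflexive (cong ι (δ-refl t))) ι-1)) (*-identityʳ x)

    ∑-δ : ∀ {m} (f : Fin m → Carrier) t → ∑ (λ u → f u * ι (δ u t)) ≈ f t
    ∑-δ {suc m} f zero = begin
      ∑ (λ u → f u * ι (δ u zero))                                      ≈⟨ ∑-suc _ ⟩
      f zero * ι (δ z z) + ∑ (λ u → f (suc u) * ι (δ (suc u) z))        ≈⟨ +-cong (δ-picks (f zero) z)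
                                                                             (∑-cong (λ u → δ-vanishes (f (suc u)) (suc u) z λ ())) ⟩
      f zero + ∑ (λ _ → 0#)                                             ≈⟨ +-congˡ ∑-zeros ⟩
      f zero + 0#                                                       ≈⟨ +-identityʳ _ ⟩
      f zero                                                            ∎
      where
      z : Fin (suc m)
      z = zero
    ∑-δ f (suc t) = begin
      ∑ (λ u → f u * ι (δ u (suc t)))                                         ≈⟨ ∑-suc _ ⟩
      f zero * ι (δ zero (suc t)) + ∑ (λ u → f (suc u) * ι (δ (suc u) (suc t))) ≈⟨ +-cong (δ-vanishes (f zero) zero (suc t) λ ())
                                                                                   (∑-cong (λ u → *-congˡ (reflexive (cong ι (δ-suc u t))))) ⟩
      0# + ∑ (λ u → f (suc u) * ι (δ u t))                                    ≈⟨ +-identityˡ _ ⟩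
      ∑ (λ u → f (suc u) * ι (δ u t))                                         ≈⟨ ∑-δ (f ∘ suc) t ⟩
      f (suc t)                                                               ∎

    ∑-𝐚 : ∀ {r J K} (c : Fin J → Fin r → ℕ) (d : Fin K → Fin r → ℕ) (f : Fin (numPts r J K) → Carrier) t →
          ∑ (λ i → f i * ι (𝐚 c d i t)) ≈ f (t ↑ˡ r) + ∑ (λ s → f (dim r J K ↑ʳ s) * ι (extraVec c d s t))
    ∑-𝐚 {r} {J} {K} c d f t = begin
      ∑ (λ i → f i * ι (𝐚 c d i t))                                           ≈⟨ ∑-splitAt n f′ ⟩
      ∑ (λ u → f (unit u) * ι (𝐚 c d (unit u) t)) + ∑ (λ s → f′ (extra s))   ≈⟨ +-cong (∑-cong (λ u → *-congˡ (reflexive (cong ι (𝐚-unit u t)))))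
                                                                                   (∑-cong (λ s → *-congˡ (reflexive (cong ι (𝐚-extra s t))))) ⟩
      ∑ (λ u → f (unit u) * ι (δ u t)) + ∑ (λ s → f (extra s) * ι (extraVec c d s t)) ≈⟨ +-congʳ (∑-δ (f ∘ unit) t) ⟩
      f (unit t) + ∑ (λ s → f (extra s) * ι (extraVec c d s t))                ∎
      where
      open Configuration c d
      f′ : Fin (numPts r J K) → Carrier
      f′ i = f i * ι (𝐚 c d i t)

toℚᵘ-toℚ : ∀ z → ℚ.toℚᵘ (toℚ z) ℚᵘ.≃ mkℚᵘ z 0
toℚᵘ-toℚ z = ℚP.toℚᵘ-fromℚᵘ (mkℚᵘ z 0)

toℚ-+ : ∀ x y → toℚ (x ℤ.+ y) ≡ toℚ x ℚ.+ toℚ y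
toℚ-+ x y = ℚP.toℚᵘ-injective (begin
  ℚ.toℚᵘ (toℚ (x ℤ.+ y))                      ≈⟨ toℚᵘ-toℚ (x ℤ.+ y) ⟩
  mkℚᵘ (x ℤ.+ y) 0                            ≈⟨ *≡* (identity x y) ⟩
  mkℚᵘ x 0 ℚᵘ.+ mkℚᵘ y 0                      ≈⟨ ℚᵘP.+-cong (toℚᵘ-toℚ x) (toℚᵘ-toℚ y) ⟨
  ℚ.toℚᵘ (toℚ x) ℚᵘ.+ ℚ.toℚᵘ (toℚ y)          ≈⟨ ℚP.toℚᵘ-homo-+ (toℚ x) (toℚ y) ⟨
  ℚ.toℚᵘ (toℚ x ℚ.+ toℚ y)                    ∎)
  where
  open ℚᵘP.≃-Reasoning
  identity : ∀ x y → (x ℤ.+ y) ℤ.* + 1 ≡ (x ℤ.* + 1 ℤ.+ y ℤ.* + 1) ℤ.* + 1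
  identity = solve-∀

toℚ-* : ∀ x y → toℚ (x ℤ.* y) ≡ toℚ x ℚ.* toℚ y
toℚ-* x y = ℚP.toℚᵘ-injective (begin
  ℚ.toℚᵘ (toℚ (x ℤ.* y))                      ≈⟨ toℚᵘ-toℚ (x ℤ.* y) ⟩
  mkℚᵘ (x ℤ.* y) 0                            ≈⟨ *≡* refl ⟩
  mkℚᵘ x 0 ℚᵘ.* mkℚᵘ y 0                      ≈⟨ ℚᵘP.*-cong (toℚᵘ-toℚ x) (toℚᵘ-toℚ y) ⟨
  ℚ.toℚᵘ (toℚ x) ℚᵘ.* ℚ.toℚᵘ (toℚ y)          ≈⟨ ℚP.toℚᵘ-homo-* (toℚ x) (toℚ y) ⟨
  ℚ.toℚᵘ (toℚ x ℚ.* toℚ y)                    ∎)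
  where open ℚᵘP.≃-Reasoning

toℚ-mono-≤ : ∀ {x y} → x ℤ.≤ y → toℚ x ℚ.≤ toℚ y
toℚ-mono-≤ {x} {y} x≤y = ℚP.toℚᵘ-cancel-≤ (begin
  ℚ.toℚᵘ (toℚ x)   ≃⟨ toℚᵘ-toℚ x ⟩
  mkℚᵘ x 0         ≤⟨ *≤* (ℤP.*-monoʳ-≤-nonNeg (+ 1) x≤y) ⟩
  mkℚᵘ y 0         ≃⟨ toℚᵘ-toℚ y ⟨
  ℚ.toℚᵘ (toℚ y)   ∎)
  where open ℚᵘP.≤-Reasoning

toℚ-suc-*-inverse : ∀ m → toℚ (+ suc m) ℚ.* (+ 1 / suc m) ≡ 1ℚ
toℚ-suc-*-inverse m = ℚP.toℚᵘ-injective (begin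
  ℚ.toℚᵘ (toℚ (+ suc m) ℚ.* (+ 1 / suc m))               ≈⟨ ℚP.toℚᵘ-homo-* (toℚ (+ suc m)) (+ 1 / suc m) ⟩
  ℚ.toℚᵘ (toℚ (+ suc m)) ℚᵘ.* ℚ.toℚᵘ (+ 1 / suc m)        ≈⟨ ℚᵘP.*-cong (toℚᵘ-toℚ (+ suc m)) (ℚP.toℚᵘ-fromℚᵘ (mkℚᵘ (+ 1) m)) ⟩
  mkℚᵘ (+ suc m) 0 ℚᵘ.* mkℚᵘ (+ 1) m                      ≈⟨ *≡* (cong (+_ ∘ suc) (arithmetic m)) ⟩
  mkℚᵘ (+ 1) 0                                            ≈⟨ ℚP.toℚᵘ-fromℚᵘ (mkℚᵘ (+ 1) 0) ⟨
  ℚ.toℚᵘ 1ℚ                                               ∎)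
  where
  open ℚᵘP.≃-Reasoning
  arithmetic : ∀ m → m ℕ.* 1 ℕ.* 1 ≡ m ℕ.+ 0 ℕ.+ 0
  arithmetic = ℕSolver.solve-∀

1/suc-pos : ∀ m → 0ℚ ℚ.< + 1 / suc m
1/suc-pos m = ℚP.positive⁻¹ _ {{ℚP.normalize-pos 1 (suc m)}}

module ∑ℤ = Sums.Properties ℤP.+-*-commutativeRing ∑ℤ (λ _ → refl) (λ _ → refl) (λ x → x) refl refl (λ _ _ → refl)
module ∑ℚ = Sums.Properties ℚP.+-*-commutativeRing ∑ℚ (λ _ → refl) (λ _ → refl) toℚ refl refl toℚ-+

∑-δ-column : ∀ {m} (k : Fin m) → ∑ℤ (λ i → δ i k) ≡ + 1
∑-δ-column k = trans (∑ℤ.∑-cong (λ i → sym (ℤP.*-identityˡ (δ i k)))) (∑ℤ.∑-δ (λ _ → + 1) k)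

∑-+δ-δ : ∀ {m} (W : Fin m → ℤ) (k k′ : Fin m) → ∑ℤ (λ i → W i ℤ.+ δ i k ℤ.+ ℤ.- δ i k′) ≡ ∑ℤ W
∑-+δ-δ W k k′ = begin
  ∑ℤ (λ i → W i ℤ.+ δ i k ℤ.+ ℤ.- δ i k′)                      ≡⟨ ∑ℤ.∑-distrib-+ (λ i → W i ℤ.+ δ i k) (λ i → ℤ.- δ i k′) ⟩
  ∑ℤ (λ i → W i ℤ.+ δ i k) ℤ.+ ∑ℤ (λ i → ℤ.- δ i k′)           ≡⟨ cong₂ ℤ._+_ (∑ℤ.∑-distrib-+ W (λ i → δ i k)) (sym (∑ℤ.neg-distrib-∑ (λ i → δ i k′))) ⟩
  ∑ℤ W ℤ.+ ∑ℤ (λ i → δ i k) ℤ.+ ℤ.- ∑ℤ (λ i → δ i k′)          ≡⟨ cong₂ (λ x y → ∑ℤ W ℤ.+ x ℤ.+ ℤ.- y) (∑-δ-column k) (∑-δ-column k′) ⟩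
  ∑ℤ W ℤ.+ + 1 ℤ.+ ℤ.- + 1                                     ≡⟨ identity (∑ℤ W) ⟩
  ∑ℤ W                                                         ∎
  where
  open ≡-Reasoning
  identity : ∀ x → x ℤ.+ + 1 ℤ.+ ℤ.- + 1 ≡ x
  identity = solve-∀

∑ℤ-mono-≤ : ∀ {m} {f g : Fin m → ℤ} → (∀ i → f i ℤ.≤ g i) → ∑ℤ f ℤ.≤ ∑ℤ g
∑ℤ-mono-≤ {zero}  _   = ℤP.≤-refl
∑ℤ-mono-≤ {suc m} f≤g = ℤP.+-mono-≤ (f≤g zero) (∑ℤ-mono-≤ (f≤g ∘ suc))

∑ℚ-mono-≤ : ∀ {m} {f g : Fin m → ℚ} → (∀ i → f i ℚ.≤ g i) → ∑ℚ f ℚ.≤ ∑ℚ g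
∑ℚ-mono-≤ {zero}  _   = ℚP.≤-refl
∑ℚ-mono-≤ {suc m} f≤g = ℚP.+-mono-≤ (f≤g zero) (∑ℚ-mono-≤ (f≤g ∘ suc))

toℚ-∑ : ∀ {m} (f : Fin m → ℤ) → toℚ (∑ℤ f) ≡ ∑ℚ (toℚ ∘ f)
toℚ-∑ {zero}  f = refl
toℚ-∑ {suc m} f = trans (toℚ-+ (f zero) (∑ℤ (f ∘ suc))) (cong (toℚ (f zero) ℚ.+_) (toℚ-∑ (f ∘ suc)))

∑ℤ-+ : ∀ {m} (f : Fin m → ℕ) → ∑ℤ (+_ ∘ f) ≡ + ∑ℕ f
∑ℤ-+ {zero}  f = refl
∑ℤ-+ {suc m} f = cong (λ x → + f zero ℤ.+ x) (∑ℤ-+ (f ∘ suc))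

term≤∑ℕ : ∀ {m} (f : Fin m → ℕ) i → f i ℕ.≤ ∑ℕ f
term≤∑ℕ f zero    = ℕP.m≤m+n (f zero) _
term≤∑ℕ f (suc i) = ℕP.≤-trans (term≤∑ℕ (f ∘ suc) i) (ℕP.m≤n+m _ (f zero))

x≤∣x∣ : ∀ x → x ℚ.≤ ℚ.∣ x ∣
x≤∣x∣ (ℚ.mkℚ (+ _)    _ _) = ℚP.≤-refl
x≤∣x∣ x@(ℚ.mkℚ -[1+ _ ] _ _) = ℚP.<⇒≤ (ℚP.neg<pos x ℚ.∣ x ∣)

-x≤∣x∣ : ∀ x → ℚ.- x ℚ.≤ ℚ.∣ x ∣
-x≤∣x∣ x = subst (ℚ.- x ℚ.≤_) (ℚP.∣-p∣≡∣p∣ x) (x≤∣x∣ (ℚ.- x))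

nonNeg-* : ∀ {x y} → 0ℚ ℚ.≤ x → 0ℚ ℚ.≤ y → 0ℚ ℚ.≤ x ℚ.* y
nonNeg-* {x} {y} 0≤x 0≤y = ℚP.nonNegative⁻¹ _ {{ℚP.nonNeg*nonNeg⇒nonNeg x {{ℚ.nonNegative 0≤x}} y {{ℚ.nonNegative 0≤y}}}}

*-monoʳ-≤ : ∀ {x y} z → 0ℚ ℚ.≤ z → x ℚ.≤ y → x ℚ.* z ℚ.≤ y ℚ.* z
*-monoʳ-≤ z 0≤z = ℚP.*-monoʳ-≤-nonNeg z {{ℚ.nonNegative 0≤z}}

≤suc⇒*1/suc≤1 : ∀ {m k} → m ℕ.≤ suc k → toℚ (+ m) ℚ.* (+ 1 / suc k) ℚ.≤ 1ℚ
≤suc⇒*1/suc≤1 {m} {k} m≤1+k =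
  subst (toℚ (+ m) ℚ.* (+ 1 / suc k) ℚ.≤_) (toℚ-suc-*-inverse k)
    (*-monoʳ-≤ (+ 1 / suc k) (ℚP.<⇒≤ (1/suc-pos k)) (toℚ-mono-≤ (ℤ.+≤+ m≤1+k)))

≤suc⇒*-*1/suc≤ : ∀ {m k} κ → 0ℚ ℚ.≤ κ → m ℕ.≤ suc k → toℚ (+ m) ℚ.* (κ ℚ.* (+ 1 / suc k)) ℚ.≤ κ
≤suc⇒*-*1/suc≤ {m} {k} κ 0≤κ m≤1+k = begin
  toℚ (+ m) ℚ.* (κ ℚ.* ν)     ≡⟨ solve 3 (λ a b c → a :* (b :* c) := b :* (a :* c)) refl (toℚ (+ m)) κ ν ⟩
  κ ℚ.* (toℚ (+ m) ℚ.* ν)     ≤⟨ ℚP.*-monoˡ-≤-nonNeg κ {{ℚ.nonNegative 0≤κ}} (≤suc⇒*1/suc≤1 m≤1+k) ⟩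
  κ ℚ.* 1ℚ                    ≡⟨ ℚP.*-identityʳ κ ⟩
  κ                           ∎
  where
  open ℚP.≤-Reasoning
  open +-*-Solver
  ν = + 1 / suc k

toℚ-suc-*-cancel : ∀ m x → toℚ (+ suc m ℤ.* x) ℚ.* (+ 1 / suc m) ≡ toℚ x
toℚ-suc-*-cancel m x = begin
  toℚ (+ suc m ℤ.* x) ℚ.* ν          ≡⟨ cong (ℚ._* ν) (toℚ-* (+ suc m) x) ⟩
  toℚ (+ suc m) ℚ.* toℚ x ℚ.* ν      ≡⟨ solve 3 (λ a b c → a :* b :* c := b :* (a :* c)) refl (toℚ (+ suc m)) (toℚ x) ν ⟩
  toℚ x ℚ.* (toℚ (+ suc m) ℚ.* ν)    ≡⟨ cong (toℚ x ℚ.*_) (toℚ-suc-*-inverse m) ⟩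
  toℚ x ℚ.* 1ℚ                       ≡⟨ ℚP.*-identityʳ (toℚ x) ⟩
  toℚ x                              ∎
  where
  open ≡-Reasoning
  open +-*-Solver
  ν = + 1 / suc m

i≤+∣i∣ : ∀ i → i ℤ.≤ + ∣ i ∣
i≤+∣i∣ (+ _)    = ℤP.≤-refl
i≤+∣i∣ -[1+ _ ] = ℤ.-≤+

-+∣i∣≤i : ∀ i → ℤ.- (+ ∣ i ∣) ℤ.≤ i
-+∣i∣≤i (+ _)    = ℤP.neg-≤-pos
-+∣i∣≤i -[1+ _ ] = ℤP.≤-refl

0≤*ℤ : ∀ {x y} → + 0 ℤ.≤ x → + 0 ℤ.≤ y → + 0 ℤ.≤ x ℤ.* y
0≤*ℤ {+ x} {+ y} _ _ = subst (+ 0 ℤ.≤_) (ℤP.pos-* x y) (ℤ.+≤+ ℕ.z≤n)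

<0⇒≤-1 : ∀ {x} → x ℤ.< + 0 → x ℤ.≤ -[1+ 0 ]
<0⇒≤-1 ℤ.-<+ = ℤ.-≤- ℕ.z≤n

x+y≡0⇒x≡-y : ∀ {x y} → x ℤ.+ y ≡ + 0 → x ≡ ℤ.- y
x+y≡0⇒x≡-y {x} {y} = inverseˡ-unique x y
  where open import Algebra.Properties.AbelianGroup ℤP.+-0-abelianGroup using (inverseˡ-unique)

x+a-b≡x⇒a≡b : ∀ x {a b} → x ℤ.+ a ℤ.+ ℤ.- b ≡ x → a ≡ b
x+a-b≡x⇒a≡b x {a} {b} eq = begin
  a                                         ≡⟨ expand x a b ⟩
  x ℤ.+ a ℤ.+ ℤ.- b ℤ.+ ℤ.- x ℤ.+ b         ≡⟨ cong (λ y → y ℤ.+ ℤ.- x ℤ.+ b) eq ⟩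
  x ℤ.+ ℤ.- x ℤ.+ b                         ≡⟨ collapse x b ⟩
  b                                         ∎
  where
  open ≡-Reasoning
  expand : ∀ x a b → a ≡ x ℤ.+ a ℤ.+ ℤ.- b ℤ.+ ℤ.- x ℤ.+ b
  expand = solve-∀
  collapse : ∀ x b → x ℤ.+ ℤ.- x ℤ.+ b ≡ b
  collapse = solve-∀

0≤-1+x⇒1≤x : ∀ {x} → + 0 ℤ.≤ -[1+ 0 ] ℤ.+ x → + 1 ℤ.≤ x
0≤-1+x⇒1≤x {x} 0≤x-1 = subst (+ 1 ℤ.≤_) (identity x) (ℤP.+-monoʳ-≤ (+ 1) 0≤x-1)
  where
  identity : ∀ x → + 1 ℤ.+ (-[1+ 0 ] ℤ.+ x) ≡ x
  identity = solve-∀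

1≰0 : ¬ (+ 1 ℤ.≤ + 0)
1≰0 (ℤ.+≤+ ())

-- (w , l) is lexicographically positive (nonnegative): w + εl > 0 (≥ 0) for every small ε > 0.
LexPositive LexNonNegative : ℤ → ℤ → Set
LexPositive    w l = (+ 1 ℤ.≤ w) ⊎ (w ≡ + 0 × + 1 ℤ.≤ l)
LexNonNegative w l = (+ 1 ℤ.≤ w) ⊎ (w ≡ + 0 × + 0 ℤ.≤ l)

module Interior {r J K : ℕ} (c : Fin J → Fin r → ℕ) (d : Fin K → Fin r → ℕ) where

  open Configuration c d
  open +-*-Solver

  weights⇒InScaledΔ : (Z : ℕ) (w : Fin N → ℚ) (q : Fin n → ℚ) →
    (∀ i → 0ℚ ℚ.≤ w i) → ∑ℚ w ℚ.≤ toℚ (+ suc Z) →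
    (∀ t → q t ≡ ∑ℚ (λ i → w i ℚ.* toℚ (𝐚 c d i t))) →
    InScaledΔ c d (+ suc Z / 1) q
  weights⇒InScaledΔ Z w q 0≤w ∑w≤Z q≡∑wa =
    (λ t → q t ℚ.* ζ) , (λ′ , 0≤λ′ , ∑λ′≡1 , barycentre) , λ t → sym (rescale (q t))
    where
    ζ = + 1 / suc Z
    0≤ζ = ℚP.<⇒≤ (1/suc-pos Z)
    Zζ≡1 = toℚ-suc-*-inverse Z

    rescale : ∀ x → toℚ (+ suc Z) ℚ.* (x ℚ.* ζ) ≡ x
    rescale x = begin
      toℚ (+ suc Z) ℚ.* (x ℚ.* ζ)   ≡⟨ solve 3 (λ z x y → z :* (x :* y) := x :* (z :* y)) refl (toℚ (+ suc Z)) x ζ ⟩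
      x ℚ.* (toℚ (+ suc Z) ℚ.* ζ)   ≡⟨ cong (x ℚ.*_) Zζ≡1 ⟩
      x ℚ.* 1ℚ                      ≡⟨ ℚP.*-identityʳ x ⟩
      x                             ∎
      where open ≡-Reasoning

    S = ∑ℚ w ℚ.* ζ

    λ′ : Fin (suc N) → ℚ
    λ′ zero    = 1ℚ ℚ.- S
    λ′ (suc i) = w i ℚ.* ζ

    0≤λ′ : ∀ i → 0ℚ ℚ.≤ λ′ i
    0≤λ′ zero    = subst₂ ℚ._≤_ (ℚP.+-inverseʳ S) refl (ℚP.+-monoˡ-≤ (ℚ.- S) S≤1)
      where S≤1 = subst (S ℚ.≤_) Zζ≡1 (*-monoʳ-≤ ζ 0≤ζ ∑w≤Z)
    0≤λ′ (suc i) = nonNeg-* (0≤w i) 0≤ζ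

    ∑λ′≡1 : ∑ℚ λ′ ≡ 1ℚ
    ∑λ′≡1 = begin
      (1ℚ ℚ.- S) ℚ.+ ∑ℚ (λ i → w i ℚ.* ζ)   ≡⟨ cong ((1ℚ ℚ.- S) ℚ.+_) (∑ℚ.*-distribʳ-∑ ζ w) ⟨
      (1ℚ ℚ.- S) ℚ.+ S                       ≡⟨ solve 2 (λ a b → (a :- b) :+ b := a) refl 1ℚ S ⟩
      1ℚ                                     ∎
      where open ≡-Reasoning

    barycentre : ∀ t → q t ℚ.* ζ ≡ ∑ℚ (λ i → λ′ i ℚ.* pointsWith0 c d i t)
    barycentre t = begin
      q t ℚ.* ζ                                              ≡⟨ cong (ℚ._* ζ) (q≡∑wa t) ⟩
      ∑ℚ (λ i → w i ℚ.* toℚ (𝐚 c d i t)) ℚ.* ζ              ≡⟨ ∑ℚ.*-distribʳ-∑ ζ (λ i → w i ℚ.* toℚ (𝐚 c d i t)) ⟩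
      ∑ℚ (λ i → (w i ℚ.* toℚ (𝐚 c d i t)) ℚ.* ζ)            ≡⟨ ∑ℚ.∑-cong (λ i → solve 3 (λ x a y → (x :* a) :* y := (x :* y) :* a) refl (w i) _ ζ) ⟩
      ∑ℚ (λ i → λ′ (suc i) ℚ.* toℚ (𝐚 c d i t))             ≡⟨ ℚP.+-identityˡ _ ⟨
      0ℚ ℚ.+ ∑ℚ (λ i → λ′ (suc i) ℚ.* toℚ (𝐚 c d i t))      ≡⟨ cong (ℚ._+ ∑ℚ (λ i → λ′ (suc i) ℚ.* toℚ (𝐚 c d i t))) (ℚP.*-zeroʳ (λ′ zero)) ⟨
      ∑ℚ (λ i → λ′ i ℚ.* pointsWith0 c d i t)               ∎
      where open ≡-Reasoning

  onUnits : (Fin n → ℚ) → Fin N → ℚ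
  onUnits x i = [ x , (λ _ → 0ℚ) ]′ (splitAt n i)

  onUnits-unit : ∀ x u → onUnits x (unit u) ≡ x u
  onUnits-unit x u = cong [ x , (λ _ → 0ℚ) ]′ (splitAt-↑ˡ n u r)

  onUnits-extra : ∀ x s → onUnits x (extra s) ≡ 0ℚ
  onUnits-extra x s = cong [ x , (λ _ → 0ℚ) ]′ (splitAt-↑ʳ n r s)

  ∑-onUnits : ∀ x → ∑ℚ (onUnits x) ≡ ∑ℚ x
  ∑-onUnits x = begin
    ∑ℚ (onUnits x)                                             ≡⟨ ∑ℚ.∑-splitAt n (onUnits x) ⟩
    ∑ℚ (onUnits x ∘ unit) ℚ.+ ∑ℚ (onUnits x ∘ extra)           ≡⟨ cong₂ ℚ._+_ (∑ℚ.∑-cong (onUnits-unit x))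
                                                                    (trans (∑ℚ.∑-cong (onUnits-extra x)) (∑ℚ.∑-zeros {r})) ⟩
    ∑ℚ x ℚ.+ 0ℚ                                                ≡⟨ ℚP.+-identityʳ _ ⟩
    ∑ℚ x                                                       ∎
    where open ≡-Reasoning

  combination-onUnits : ∀ x t → ∑ℚ (λ i → onUnits x i ℚ.* toℚ (𝐚 c d i t)) ≡ x t
  combination-onUnits x t = begin
    ∑ℚ (λ i → onUnits x i ℚ.* toℚ (𝐚 c d i t))                                   ≡⟨ ∑ℚ.∑-𝐚 c d (onUnits x) t ⟩
    onUnits x (unit t) ℚ.+ ∑ℚ (λ s → onUnits x (extra s) ℚ.* toℚ (extraVec c d s t)) ≡⟨ cong₂ ℚ._+_ (onUnits-unit x t)
                                                                                      (trans (∑ℚ.∑-cong vanish) (∑ℚ.∑-zeros {r})) ⟩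
    x t ℚ.+ 0ℚ                                                                    ≡⟨ ℚP.+-identityʳ _ ⟩
    x t                                                                           ∎
    where
    open ≡-Reasoning
    vanish : ∀ s → onUnits x (extra s) ℚ.* toℚ (extraVec c d s t) ≡ 0ℚ
    vanish s = trans (cong (ℚ._* toℚ (extraVec c d s t)) (onUnits-extra x s)) (ℚP.*-zeroˡ (toℚ (extraVec c d s t)))

  positiveWeights⇒interior : (Z : ℕ) (μ : Fin N → ℚ) (ε : ℚ) (p : Fin n → ℚ) →
    0ℚ ℚ.< ε → (∀ u → ε ℚ.≤ μ (unit u)) → (∀ s → 0ℚ ℚ.≤ μ (extra s)) →
    ∑ℚ μ ℚ.+ toℚ (+ n) ℚ.* ε ℚ.≤ toℚ (+ suc Z) →
    (∀ t → p t ≡ ∑ℚ (λ i → μ i ℚ.* toℚ (𝐚 c d i t))) →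
    IsInteriorPt (InScaledΔ c d (+ suc Z / 1)) p
  positiveWeights⇒interior Z μ ε p 0<ε ε≤μ 0≤μ ∑μ+nε≤Z p≡∑μa = ε , 0<ε , near⇒InScaledΔ
    where
    near⇒InScaledΔ : ∀ q → (∀ t → ℚ.∣ q t ℚ.- p t ∣ ℚ.< ε) → InScaledΔ c d (+ suc Z / 1) q
    near⇒InScaledΔ q near = weights⇒InScaledΔ Z w q 0≤w ∑w≤Z q≡∑wa
      where
      gap : Fin n → ℚ
      gap t = q t ℚ.- p t

      w : Fin N → ℚ
      w i = μ i ℚ.+ onUnits gap i

      0≤w : ∀ i → 0ℚ ℚ.≤ w i
      0≤w i with split n i
      ... | left u  = subst₂ ℚ._≤_ (ℚP.+-inverseˡ (gap u)) (cong (μ (unit u) ℚ.+_) (sym (onUnits-unit gap u)))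
                        (ℚP.+-monoˡ-≤ (gap u) (ℚP.≤-trans (-x≤∣x∣ (gap u)) (ℚP.≤-trans (ℚP.<⇒≤ (near u)) (ε≤μ u))))
      ... | right s = subst (0ℚ ℚ.≤_) (trans (sym (ℚP.+-identityʳ _)) (cong (μ (extra s) ℚ.+_) (sym (onUnits-extra gap s)))) (0≤μ s)

      ∑w≤Z : ∑ℚ w ℚ.≤ toℚ (+ suc Z)
      ∑w≤Z = begin
        ∑ℚ w                              ≡⟨ ∑ℚ.∑-distrib-+ μ (onUnits gap) ⟩
        ∑ℚ μ ℚ.+ ∑ℚ (onUnits gap)         ≡⟨ cong (∑ℚ μ ℚ.+_) (∑-onUnits gap) ⟩
        ∑ℚ μ ℚ.+ ∑ℚ gap                   ≤⟨ ℚP.+-monoʳ-≤ (∑ℚ μ) (∑ℚ-mono-≤ {f = gap} (λ t → ℚP.≤-trans (x≤∣x∣ (gap t)) (ℚP.<⇒≤ (near t)))) ⟩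
        ∑ℚ μ ℚ.+ ∑ℚ {n} (λ _ → ε)         ≡⟨ cong (∑ℚ μ ℚ.+_) (∑ℚ.∑-const {n} ε) ⟩
        ∑ℚ μ ℚ.+ toℚ (+ n) ℚ.* ε          ≤⟨ ∑μ+nε≤Z ⟩
        toℚ (+ suc Z)                     ∎
        where open ℚP.≤-Reasoning

      q≡∑wa : ∀ t → q t ≡ ∑ℚ (λ i → w i ℚ.* toℚ (𝐚 c d i t))
      q≡∑wa t = sym (begin
        ∑ℚ (λ i → w i ℚ.* toℚ (𝐚 c d i t))                          ≡⟨ ∑ℚ.∑-cong (λ i → ℚP.*-distribʳ-+ (toℚ (𝐚 c d i t)) (μ i) _) ⟩
        ∑ℚ (λ i → μ i ℚ.* toℚ (𝐚 c d i t) ℚ.+ onUnits gap i ℚ.* toℚ (𝐚 c d i t)) ≡⟨ ∑ℚ.∑-distrib-+ (λ i → μ i ℚ.* toℚ (𝐚 c d i t)) (λ i → onUnits gap i ℚ.* toℚ (𝐚 c d i t)) ⟩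
        ∑ℚ (λ i → μ i ℚ.* toℚ (𝐚 c d i t)) ℚ.+ ∑ℚ (λ i → onUnits gap i ℚ.* toℚ (𝐚 c d i t)) ≡⟨ cong₂ ℚ._+_ (sym (p≡∑μa t)) (combination-onUnits gap t) ⟩
        p t ℚ.+ (q t ℚ.- p t)                                       ≡⟨ solve 2 (λ x y → x :+ (y :- x) := y) refl (p t) (q t) ⟩
        q t                                                         ∎)
        where open ≡-Reasoning

  integerWeights⇒interior : (Z D : ℕ) (V : Fin N → ℤ) (p : Fin n → ℤ) →
    (∀ u → + 1 ℤ.≤ V (unit u)) → (∀ s → + 0 ℤ.≤ V (extra s)) →
    ∑ℤ V ℤ.+ + 1 ℤ.≤ + suc Z ℤ.* + suc D →
    (∀ t → combination V t ≡ + suc D ℤ.* p t) →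
    IsInteriorLatticePt (InScaledΔ c d (+ suc Z / 1)) p
  integerWeights⇒interior Z D V p 1≤V 0≤V ∑V<ZD ∑Va≡Dp =
    positiveWeights⇒interior Z μ ε (toℚ ∘ p) 0<ε ε≤μ 0≤μ ∑μ+nε≤Z p≡∑μa
    where
    -- μ = V/(D+1) is ≥ κ on the units and leaves a margin κ below Z + 1; n·ε ≤ κ fits into it.
    κ ν ε : ℚ
    κ = + 1 / suc D
    ν = + 1 / suc n
    ε = κ ℚ.* ν

    μ : Fin N → ℚ
    μ i = toℚ (V i) ℚ.* κ

    0≤κ = ℚP.<⇒≤ (1/suc-pos D)

    0<ε : 0ℚ ℚ.< ε
    0<ε = subst (ℚ._< ε) (ℚP.*-zeroˡ ν) (ℚP.*-monoˡ-<-pos ν {{ℚ.positive (1/suc-pos n)}} (1/suc-pos D))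

    ε≤κ : ε ℚ.≤ κ
    ε≤κ = subst (ℚ._≤ κ) (ℚP.*-identityˡ ε) (≤suc⇒*-*1/suc≤ κ 0≤κ (ℕ.s≤s (ℕ.z≤n {n})))

    ε≤μ : ∀ u → ε ℚ.≤ μ (unit u)
    ε≤μ u = ℚP.≤-trans ε≤κ (subst (ℚ._≤ μ (unit u)) (ℚP.*-identityˡ κ) (*-monoʳ-≤ κ 0≤κ (toℚ-mono-≤ (1≤V u))))

    0≤μ : ∀ s → 0ℚ ℚ.≤ μ (extra s)
    0≤μ s = nonNeg-* (toℚ-mono-≤ (0≤V s)) 0≤κ

    ∑μ≡ : ∑ℚ μ ≡ toℚ (∑ℤ V) ℚ.* κ
    ∑μ≡ = trans (sym (∑ℚ.*-distribʳ-∑ κ (toℚ ∘ V))) (cong (ℚ._* κ) (sym (toℚ-∑ V)))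

    ∑μ+nε≤Z : ∑ℚ μ ℚ.+ toℚ (+ n) ℚ.* ε ℚ.≤ toℚ (+ suc Z)
    ∑μ+nε≤Z = begin
      ∑ℚ μ ℚ.+ toℚ (+ n) ℚ.* ε                 ≤⟨ ℚP.+-monoʳ-≤ (∑ℚ μ) (≤suc⇒*-*1/suc≤ κ 0≤κ (ℕP.n≤1+n n)) ⟩
      ∑ℚ μ ℚ.+ κ                               ≡⟨ cong₂ ℚ._+_ ∑μ≡ (sym (ℚP.*-identityˡ κ)) ⟩
      toℚ (∑ℤ V) ℚ.* κ ℚ.+ 1ℚ ℚ.* κ            ≡⟨ ℚP.*-distribʳ-+ κ (toℚ (∑ℤ V)) 1ℚ ⟨
      (toℚ (∑ℤ V) ℚ.+ 1ℚ) ℚ.* κ                ≡⟨ cong (ℚ._* κ) (toℚ-+ (∑ℤ V) (+ 1)) ⟨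
      toℚ (∑ℤ V ℤ.+ + 1) ℚ.* κ                 ≤⟨ *-monoʳ-≤ κ 0≤κ (toℚ-mono-≤ (ℤP.≤-trans ∑V<ZD (ℤP.≤-reflexive (ℤP.*-comm (+ suc Z) (+ suc D))))) ⟩
      toℚ (+ suc D ℤ.* + suc Z) ℚ.* κ          ≡⟨ toℚ-suc-*-cancel D (+ suc Z) ⟩
      toℚ (+ suc Z)                            ∎
      where open ℚP.≤-Reasoning

    p≡∑μa : ∀ t → toℚ (p t) ≡ ∑ℚ (λ i → μ i ℚ.* toℚ (𝐚 c d i t))
    p≡∑μa t = begin
      toℚ (p t)                                              ≡⟨ toℚ-suc-*-cancel D (p t) ⟨
      toℚ (+ suc D ℤ.* p t) ℚ.* κ                            ≡⟨ cong (λ x → toℚ x ℚ.* κ) (∑Va≡Dp t) ⟨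
      toℚ (∑ℤ (λ i → V i ℤ.* 𝐚 c d i t)) ℚ.* κ               ≡⟨ cong (ℚ._* κ) (toℚ-∑ (λ i → V i ℤ.* 𝐚 c d i t)) ⟩
      ∑ℚ (λ i → toℚ (V i ℤ.* 𝐚 c d i t)) ℚ.* κ               ≡⟨ ∑ℚ.*-distribʳ-∑ κ (λ i → toℚ (V i ℤ.* 𝐚 c d i t)) ⟩
      ∑ℚ (λ i → toℚ (V i ℤ.* 𝐚 c d i t) ℚ.* κ)               ≡⟨ ∑ℚ.∑-cong (λ i → trans (cong (ℚ._* κ) (toℚ-* (V i) (𝐚 c d i t)))
                                                                  (solve 3 (λ v a k → v :* a :* k := v :* k :* a) refl (toℚ (V i)) (toℚ (𝐚 c d i t)) κ)) ⟩
      ∑ℚ (λ i → μ i ℚ.* toℚ (𝐚 c d i t))                     ∎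
      where open ≡-Reasoning

  perturbation⇒interior : (Z : ℕ) (W l : Fin N → ℤ) →
    (∀ u → LexPositive (W (unit u)) (l (unit u))) → (∀ s → LexNonNegative (W (extra s)) (l (extra s))) →
    ∑ℤ W ℤ.≤ + Z → InL c d l →
    IsInteriorLatticePt (InScaledΔ c d (+ suc Z / 1)) (combination W)
  perturbation⇒interior Z W l W,l>0 W,l≥0 ∑W≤Z l∈L =
    integerWeights⇒interior Z M V (combination W) 1≤V 0≤V ∑V<ZD ∑Va≡DWa
    where
    -- D > ∑ |lᵢ| makes D·W + l positive wherever (W, l) is lexicographically positive.
    M = ∑ℕ (∣_∣ ∘ l)
    D = + suc M

    V : Fin N → ℤ
    V i = D ℤ.* W i ℤ.+ l i

    1≤W⇒1≤V : ∀ i → + 1 ℤ.≤ W i → + 1 ℤ.≤ V i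
    1≤W⇒1≤V i 1≤W = subst (ℤ._≤ V i) (identity (+ M))
      (ℤP.+-mono-≤ (ℤP.≤-trans (ℤP.≤-reflexive (sym (ℤP.*-identityʳ D))) (ℤP.*-monoˡ-≤-nonNeg D 1≤W))
                   (ℤP.≤-trans (ℤP.neg-mono-≤ (ℤ.+≤+ (term≤∑ℕ (∣_∣ ∘ l) i))) (-+∣i∣≤i (l i))))
      where
      identity : ∀ x → (+ 1 ℤ.+ x) ℤ.+ ℤ.- x ≡ + 1
      identity = solve-∀

    W≡0⇒V≡l : ∀ i → W i ≡ + 0 → V i ≡ l i
    W≡0⇒V≡l i W≡0 = trans (cong (λ x → D ℤ.* x ℤ.+ l i) W≡0) (trans (cong (ℤ._+ l i) (ℤP.*-zeroʳ D)) (ℤP.+-identityˡ (l i)))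

    1≤V : ∀ u → + 1 ℤ.≤ V (unit u)
    1≤V u with W,l>0 u
    ... | inj₁ 1≤W         = 1≤W⇒1≤V (unit u) 1≤W
    ... | inj₂ (W≡0 , 1≤l) = subst (+ 1 ℤ.≤_) (sym (W≡0⇒V≡l (unit u) W≡0)) 1≤l

    0≤V : ∀ s → + 0 ℤ.≤ V (extra s)
    0≤V s with W,l≥0 s
    ... | inj₁ 1≤W         = ℤP.≤-trans (ℤ.+≤+ ℕ.z≤n) (1≤W⇒1≤V (extra s) 1≤W)
    ... | inj₂ (W≡0 , 0≤l) = subst (+ 0 ℤ.≤_) (sym (W≡0⇒V≡l (extra s) W≡0)) 0≤l

    ∑V<ZD : ∑ℤ V ℤ.+ + 1 ℤ.≤ + suc Z ℤ.* D
    ∑V<ZD = begin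
      ∑ℤ V ℤ.+ + 1                        ≡⟨ cong (ℤ._+ + 1) (trans (∑ℤ.∑-distrib-+ (λ i → D ℤ.* W i) l)
                                                                   (cong (ℤ._+ ∑ℤ l) (sym (∑ℤ.*-distribˡ-∑ D W)))) ⟩
      D ℤ.* ∑ℤ W ℤ.+ ∑ℤ l ℤ.+ + 1         ≤⟨ ℤP.+-monoˡ-≤ (+ 1) (ℤP.+-mono-≤ (ℤP.*-monoˡ-≤-nonNeg D ∑W≤Z) ∑l≤M) ⟩
      D ℤ.* + Z ℤ.+ + M ℤ.+ + 1           ≡⟨ identity (+ Z) (+ M) ⟩
      + suc Z ℤ.* D                       ∎
      where
      open ℤP.≤-Reasoning
      ∑l≤M : ∑ℤ l ℤ.≤ + M
      ∑l≤M = ℤP.≤-trans (∑ℤ-mono-≤ (i≤+∣i∣ ∘ l)) (ℤP.≤-reflexive (∑ℤ-+ (∣_∣ ∘ l)))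
      identity : ∀ z m → (+ 1 ℤ.+ m) ℤ.* z ℤ.+ m ℤ.+ + 1 ≡ (+ 1 ℤ.+ z) ℤ.* (+ 1 ℤ.+ m)
      identity = solve-∀

    ∑Va≡DWa : ∀ t → combination V t ≡ D ℤ.* combination W t
    ∑Va≡DWa t = begin
      ∑ℤ (λ i → (D ℤ.* W i ℤ.+ l i) ℤ.* 𝐚 c d i t)                       ≡⟨ ∑ℤ.∑-cong (λ i → distrib D (W i) (l i) (𝐚 c d i t)) ⟩
      ∑ℤ (λ i → D ℤ.* (W i ℤ.* 𝐚 c d i t) ℤ.+ l i ℤ.* 𝐚 c d i t)        ≡⟨ ∑ℤ.∑-distrib-+ (λ i → D ℤ.* (W i ℤ.* 𝐚 c d i t)) (λ i → l i ℤ.* 𝐚 c d i t) ⟩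
      ∑ℤ (λ i → D ℤ.* (W i ℤ.* 𝐚 c d i t)) ℤ.+ combination l t          ≡⟨ cong₂ ℤ._+_ (sym (∑ℤ.*-distribˡ-∑ D (λ i → W i ℤ.* 𝐚 c d i t))) (l∈L t) ⟩
      D ℤ.* combination W t ℤ.+ + 0                                     ≡⟨ ℤP.+-identityʳ _ ⟩
      D ℤ.* combination W t                                             ∎
      where
      open ≡-Reasoning
      distrib : ∀ D w l a → (D ℤ.* w ℤ.+ l) ℤ.* a ≡ D ℤ.* (w ℤ.* a) ℤ.+ l ℤ.* a
      distrib = solve-∀

module Minimality {r J K : ℕ} (c : Fin J → Fin r → ℕ) (d : Fin K → Fin r → ℕ) where

  open Configuration c d
  open Interior c d

  v : Fin N → ℤ
  v = v0 {r} {J} {K}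

  shrinking⇒nonNeg : ∀ (s : Fin r) (l : Fin N → ℤ) → (∀ i → InNSupp (extra s) (λ k → v k ℤ.+ l k) i → InNSupp (extra s) v i) →
                     ∀ i → i ≢ extra s → v i ≡ + 0 → + 0 ℤ.≤ l i
  shrinking⇒nonNeg s l shrinks i i≢ v≡0 with l i ℤP.<? + 0
  ... | no  l≮0 = ℤP.≮⇒≥ l≮0
  ... | yes l<0 = ⊥-elim (ℤP.<-irrefl refl (subst (ℤ._< + 0) v≡0 (proj₂ (shrinks i (i≢ , subst (ℤ._< + 0) (sym v+l≡l) l<0)))))
    where v+l≡l = trans (cong (ℤ._+ l i) v≡0) (ℤP.+-identityˡ (l i))

  dropped⇒front : ∀ (s : Fin r) (l : Fin N → ℤ) i → InNSupp (extra s) v i → ¬ InNSupp (extra s) (λ k → v k ℤ.+ l k) i →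
                  ∃ λ t → + 1 ℤ.≤ l (front t)
  dropped⇒front s l i (i≢ , v<0) kept with split n i
  ... | right s′ = ⊥-elim (ℤP.<-irrefl refl (subst (ℤ._< + 0) (v0-extra s′) v<0))
  ... | left u with split (r ℕ.+ J) u
  ...   | right k = ⊥-elim (ℤP.<-irrefl refl (subst (ℤ._< + 0) (v0-back k) v<0))
  ...   | left t  = t , 0≤-1+x⇒1≤x (subst (λ x → + 0 ℤ.≤ x ℤ.+ l (front t)) (v0-front t) (ℤP.≮⇒≥ (λ v+l<0 → kept (i≢ , v+l<0))))

  front-nonPos : ∀ (l : Fin N → ℤ) → InL c d l → (∀ s → + 0 ℤ.≤ l (extra s)) → ∀ t → l (front t) ℤ.≤ + 0
  front-nonPos l l∈L 0≤l t = subst (ℤ._≤ + 0) (sym (x+y≡0⇒x≡-y (trans (sym (∑ℤ.∑-𝐚 c d l (t ↑ˡ K))) (l∈L (t ↑ˡ K)))))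
    (ℤP.neg-mono-≤ (subst (ℤ._≤ E) (∑ℤ.∑-zeros {r}) (∑ℤ-mono-≤ (λ s → 0≤*ℤ (0≤l s) (extraVec-front-nonNeg s t)))))
    where E = ∑ℤ (λ s → l (extra s) ℤ.* extraVec c d s (t ↑ˡ K))

  extra-negative : ∀ (s : Fin r) (l : Fin N → ℤ) → InL c d l → (∀ s′ → s′ ≢ s → + 0 ℤ.≤ l (extra s′)) →
                   ∃ (λ t → + 1 ℤ.≤ l (front t)) → l (extra s) ℤ.< + 0
  extra-negative s l l∈L 0≤l (t , 1≤l) with l (extra s) ℤP.<? + 0
  ... | yes l<0 = l<0
  ... | no  l≮0 = ⊥-elim (1≰0 (ℤP.≤-trans 1≤l (front-nonPos l l∈L 0≤l-all t)))
    where
    0≤l-all : ∀ s′ → + 0 ℤ.≤ l (extra s′)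
    0≤l-all s′ with s′ ≟ᶠ s
    ... | yes refl = ℤP.≮⇒≥ l≮0
    ... | no  s′≢s = 0≤l s′ s′≢s

  sUnit-positive : ∀ (s : Fin r) (l : Fin N → ℤ) → InL c d l → l (extra s) ℤ.< + 0 → + 1 ℤ.≤ l (unit (sCoord s))
  sUnit-positive s l l∈L l<0 = subst (+ 1 ℤ.≤_) (sym (x+y≡0⇒x≡-y lattice-at-sCoord)) (ℤP.neg-mono-≤ (<0⇒≤-1 l<0))
    where
    lattice-at-sCoord : l (unit (sCoord s)) ℤ.+ l (extra s) ≡ + 0
    lattice-at-sCoord = begin
      l (unit (sCoord s)) ℤ.+ l (extra s)                                            ≡⟨ cong (λ x → l (unit (sCoord s)) ℤ.+ x) (∑ℤ.∑-δ (l ∘ extra) s) ⟨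
      l (unit (sCoord s)) ℤ.+ ∑ℤ (λ s′ → l (extra s′) ℤ.* δ s′ s)                     ≡⟨ cong (λ x → l (unit (sCoord s)) ℤ.+ x)
                                                                                          (∑ℤ.∑-cong (λ s′ → cong (l (extra s′) ℤ.*_) (extraVec-s s′ s))) ⟨
      l (unit (sCoord s)) ℤ.+ ∑ℤ (λ s′ → l (extra s′) ℤ.* extraVec c d s′ (sCoord s)) ≡⟨ ∑ℤ.∑-𝐚 c d l (sCoord s) ⟨
      combination l (sCoord s)                                                       ≡⟨ l∈L (sCoord s) ⟩
      + 0                                                                            ∎
      where open ≡-Reasoning

  -- the lattice vector ∑ₛ (e_{n+s} − ∑ₜ (a_{n+s})ₜ e_t)
  balance : Fin N → ℤ
  balance i = [ (λ u → ℤ.- ∑ℤ (λ s → extraVec c d s u)) , (λ _ → + 1) ]′ (splitAt n i)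

  balance-unit : ∀ u → balance (unit u) ≡ ℤ.- ∑ℤ (λ s → extraVec c d s u)
  balance-unit u = cong [ (λ u → ℤ.- ∑ℤ (λ s → extraVec c d s u)) , (λ _ → + 1) ]′ (splitAt-↑ˡ n u r)

  balance-extra : ∀ s → balance (extra s) ≡ + 1
  balance-extra s = cong [ (λ u → ℤ.- ∑ℤ (λ s → extraVec c d s u)) , (λ _ → + 1) ]′ (splitAt-↑ʳ n r s)

  balance∈L : InL c d balance
  balance∈L t = begin
    combination balance t                                                   ≡⟨ ∑ℤ.∑-𝐚 c d balance t ⟩
    balance (unit t) ℤ.+ ∑ℤ (λ s → balance (extra s) ℤ.* extraVec c d s t)  ≡⟨ cong₂ ℤ._+_ (balance-unit t)
                                                                                (∑ℤ.∑-cong (λ s → trans (cong (ℤ._* extraVec c d s t) (balance-extra s)) (ℤP.*-identityˡ (extraVec c d s t)))) ⟩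
    ℤ.- ∑ℤ (λ s → extraVec c d s t) ℤ.+ ∑ℤ (λ s → extraVec c d s t)         ≡⟨ ℤP.+-inverseˡ (∑ℤ (λ s → extraVec c d s t)) ⟩
    + 0                                                                     ∎
    where open ≡-Reasoning

  balance-sCoord : ∀ s → balance (unit (sCoord s)) ≡ -[1+ 0 ]
  balance-sCoord s = begin
    balance (unit (sCoord s))                         ≡⟨ balance-unit (sCoord s) ⟩
    ℤ.- ∑ℤ (λ s′ → extraVec c d s′ (sCoord s))        ≡⟨ cong ℤ.-_ (∑ℤ.∑-cong (λ s′ → trans (extraVec-s s′ s) (sym (ℤP.*-identityˡ _)))) ⟩
    ℤ.- ∑ℤ (λ s′ → + 1 ℤ.* δ s′ s)                    ≡⟨ cong ℤ.-_ (∑ℤ.∑-δ (λ _ → + 1) s) ⟩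
    -[1+ 0 ]                                          ∎
    where open ≡-Reasoning

  balance-back : ∀ k → ¬ (∀ s → d k s ≡ 0) → + 1 ℤ.≤ balance (back k)
  balance-back k d≢0 = subst (+ 1 ℤ.≤_) (sym balance≡∑d)
    (ℤ.+≤+ (ℕP.≤-trans (ℕP.n≢0⇒n>0 (proj₂ nonzero)) (term≤∑ℕ (d k) (proj₁ nonzero))))
    where
    nonzero : ∃ λ s → d k s ≢ 0
    nonzero = ¬∀⟶∃¬ r (λ s → d k s ≡ 0) (λ s → d k s ℕ.≟ 0) d≢0
    balance≡∑d : balance (back k) ≡ + ∑ℕ (d k)
    balance≡∑d = begin
      balance (back k)                              ≡⟨ balance-unit (kCoord k) ⟩
      ℤ.- ∑ℤ (λ s → extraVec c d s (kCoord k))      ≡⟨ cong ℤ.-_ (∑ℤ.∑-cong (λ s → extraVec-k s k)) ⟩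
      ℤ.- ∑ℤ (λ s → ℤ.- (+ d k s))                  ≡⟨ cong ℤ.-_ (∑ℤ.neg-distrib-∑ (+_ ∘ d k)) ⟨
      ℤ.- ℤ.- ∑ℤ (+_ ∘ d k)                         ≡⟨ ℤP.neg-involutive _ ⟩
      ∑ℤ (+_ ∘ d k)                                 ≡⟨ ∑ℤ-+ (d k) ⟩
      + ∑ℕ (d k)                                    ∎
      where open ≡-Reasoning

  frontIndicator : Fin N → ℤ
  frontIndicator i = ℤ.- v i

  frontIndicator-front : ∀ t → frontIndicator (front t) ≡ + 1
  frontIndicator-front t = cong ℤ.-_ (v0-front t)

  frontIndicator-back : ∀ k → frontIndicator (back k) ≡ + 0
  frontIndicator-back k = cong ℤ.-_ (v0-back k)

  frontIndicator-extra : ∀ s → frontIndicator (extra s) ≡ + 0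
  frontIndicator-extra s = cong ℤ.-_ (v0-extra s)

  ∑frontIndicator : ∑ℤ frontIndicator ≡ + (r ℕ.+ J)
  ∑frontIndicator = begin
    ∑ℤ frontIndicator                                                      ≡⟨ ∑ℤ.∑-splitAt n frontIndicator ⟩
    ∑ℤ (frontIndicator ∘ unit) ℤ.+ ∑ℤ (frontIndicator ∘ extra)             ≡⟨ cong₂ ℤ._+_ (∑ℤ.∑-splitAt (r ℕ.+ J) (frontIndicator ∘ unit))
                                                                               (trans (∑ℤ.∑-cong frontIndicator-extra) (∑ℤ.∑-zeros {r})) ⟩
    ∑ℤ (frontIndicator ∘ front) ℤ.+ ∑ℤ (frontIndicator ∘ back) ℤ.+ + 0     ≡⟨ cong (λ x → x ℤ.+ + 0) (cong₂ ℤ._+_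
                                                                               (trans (∑ℤ.∑-cong frontIndicator-front) (∑ℤ.∑-const {r ℕ.+ J} (+ 1)))
                                                                               (trans (∑ℤ.∑-cong frontIndicator-back) (∑ℤ.∑-zeros {K}))) ⟩
    + (r ℕ.+ J) ℤ.* + 1 ℤ.+ + 0 ℤ.+ + 0                                    ≡⟨ identity (+ (r ℕ.+ J)) ⟩
    + (r ℕ.+ J)                                                            ∎
    where
    open ≡-Reasoning
    identity : ∀ x → x ℤ.* + 1 ℤ.+ + 0 ℤ.+ + 0 ≡ x
    identity = solve-∀

  frontSum-interior : (∀ k → ¬ (∀ s → d k s ≡ 0)) →
    IsInteriorLatticePt (InScaledΔ c d (+ suc (J ℕ.+ r) / 1)) (combination frontIndicator)
  frontSum-interior d≢0 = perturbation⇒interior (J ℕ.+ r) frontIndicator balance lexPositive lexNonNegative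
    (ℤP.≤-reflexive (trans ∑frontIndicator (cong +_ (ℕP.+-comm r J)))) balance∈L
    where
    lexPositive : ∀ u → LexPositive (frontIndicator (unit u)) (balance (unit u))
    lexPositive u with split (r ℕ.+ J) u
    ... | left  t = inj₁ (ℤP.≤-reflexive (sym (frontIndicator-front t)))
    ... | right k = inj₂ (frontIndicator-back k , balance-back k (d≢0 k))
    lexNonNegative : ∀ s → LexNonNegative (frontIndicator (extra s)) (balance (extra s))
    lexNonNegative s = inj₂ (frontIndicator-extra s , ℤP.≤-trans (ℤ.+≤+ ℕ.z≤n) (ℤP.≤-reflexive (sym (balance-extra s))))

  combination-δ : ∀ (k : Fin N) t → combination (λ i → δ i k) t ≡ 𝐚 c d k t
  combination-δ k t = trans (∑ℤ.∑-cong (λ i → ℤP.*-comm (δ i k) (𝐚 c d i t))) (∑ℤ.∑-δ (λ i → 𝐚 c d i t) k)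

  combination-+δ-δ : ∀ (W : Fin N → ℤ) (k k′ : Fin N) t → combination (λ i → W i ℤ.+ δ i k ℤ.+ ℤ.- δ i k′) t ≡
                                   combination W t ℤ.+ 𝐚 c d k t ℤ.+ ℤ.- 𝐚 c d k′ t
  combination-+δ-δ W k k′ t = begin
    ∑ℤ (λ i → (W i ℤ.+ δ i k ℤ.+ ℤ.- δ i k′) ℤ.* a i)                   ≡⟨ ∑ℤ.∑-cong (λ i → distrib (W i) (δ i k) (δ i k′) (a i)) ⟩
    ∑ℤ (λ i → W i ℤ.* a i ℤ.+ δ i k ℤ.* a i ℤ.+ ℤ.- (δ i k′ ℤ.* a i))    ≡⟨ ∑ℤ.∑-distrib-+ (λ i → W i ℤ.* a i ℤ.+ δ i k ℤ.* a i) (λ i → ℤ.- (δ i k′ ℤ.* a i)) ⟩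
    ∑ℤ (λ i → W i ℤ.* a i ℤ.+ δ i k ℤ.* a i) ℤ.+ ∑ℤ (λ i → ℤ.- (δ i k′ ℤ.* a i)) ≡⟨ cong₂ ℤ._+_ (∑ℤ.∑-distrib-+ (λ i → W i ℤ.* a i) (λ i → δ i k ℤ.* a i))
                                                                                     (sym (∑ℤ.neg-distrib-∑ (λ i → δ i k′ ℤ.* a i))) ⟩
    combination W t ℤ.+ combination (λ i → δ i k) t ℤ.+ ℤ.- combination (λ i → δ i k′) t
                                                                         ≡⟨ cong₂ (λ x y → combination W t ℤ.+ x ℤ.+ ℤ.- y) (combination-δ k t) (combination-δ k′ t) ⟩
    combination W t ℤ.+ 𝐚 c d k t ℤ.+ ℤ.- 𝐚 c d k′ t                      ∎
    where
    open ≡-Reasoning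
    a : Fin N → ℤ
    a i = 𝐚 c d i t
    distrib : ∀ w x y z → (w ℤ.+ x ℤ.+ ℤ.- y) ℤ.* z ≡ w ℤ.* z ℤ.+ x ℤ.* z ℤ.+ ℤ.- (y ℤ.* z)
    distrib = solve-∀

  front≢extra : ∀ t s → front t ≢ extra s
  front≢extra t s = ↑ˡ≢↑ʳ (t ↑ˡ K) s

  back≢extra : ∀ k s → back k ≢ extra s
  back≢extra k s = ↑ˡ≢↑ʳ (kCoord k) s

  module Shifted (s : Fin r) where

    sUnit : Fin N
    sUnit = unit (sCoord s)

    shifted : Fin N → ℤ
    shifted i = frontIndicator i ℤ.+ δ i (extra s) ℤ.+ ℤ.- δ i sUnit

    shifted-≢ : ∀ i → i ≢ extra s → i ≢ sUnit → shifted i ≡ frontIndicator i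
    shifted-≢ i i≢e i≢u = begin
      frontIndicator i ℤ.+ δ i (extra s) ℤ.+ ℤ.- δ i sUnit   ≡⟨ cong₂ (λ x y → frontIndicator i ℤ.+ x ℤ.+ ℤ.- y) (δ-≢ i≢e) (δ-≢ i≢u) ⟩
      frontIndicator i ℤ.+ + 0 ℤ.+ + 0                        ≡⟨ trans (ℤP.+-identityʳ _) (ℤP.+-identityʳ _) ⟩
      frontIndicator i                                        ∎
      where open ≡-Reasoning

    shifted-sUnit : shifted sUnit ≡ + 0
    shifted-sUnit = begin
      frontIndicator sUnit ℤ.+ δ sUnit (extra s) ℤ.+ ℤ.- δ sUnit sUnit   ≡⟨ cong₂ (λ x y → x ℤ.+ y ℤ.+ ℤ.- δ sUnit sUnit)
                                                                            (frontIndicator-front (s ↑ˡ J)) (δ-≢ (front≢extra (s ↑ˡ J) s)) ⟩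
      + 1 ℤ.+ + 0 ℤ.+ ℤ.- δ sUnit sUnit                                 ≡⟨ cong (λ y → + 1 ℤ.+ + 0 ℤ.+ ℤ.- y) (δ-refl sUnit) ⟩
      + 0                                                               ∎
      where open ≡-Reasoning

    shifted-extra : shifted (extra s) ≡ + 1
    shifted-extra = begin
      frontIndicator (extra s) ℤ.+ δ (extra s) (extra s) ℤ.+ ℤ.- δ (extra s) sUnit ≡⟨ cong₂ (λ x y → x ℤ.+ y ℤ.+ ℤ.- δ (extra s) sUnit)
                                                                                      (frontIndicator-extra s) (δ-refl (extra s)) ⟩
      + 0 ℤ.+ + 1 ℤ.+ ℤ.- δ (extra s) sUnit                                       ≡⟨ cong (λ y → + 0 ℤ.+ + 1 ℤ.+ ℤ.- y) (δ-≢ (front≢extra (s ↑ˡ J) s ∘ sym)) ⟩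
      + 1                                                                         ∎
      where open ≡-Reasoning

    ∑shifted : ∑ℤ shifted ≡ + (r ℕ.+ J)
    ∑shifted = trans (∑-+δ-δ frontIndicator (extra s) sUnit) ∑frontIndicator

    shifted-interior : (∀ k → ¬ (∀ s → d k s ≡ 0)) → (l : Fin N → ℤ) → InL c d l →
      (∀ k → + 0 ℤ.≤ l (back k)) → (∀ s′ → s′ ≢ s → + 0 ℤ.≤ l (extra s′)) → + 1 ℤ.≤ l sUnit →
      IsInteriorLatticePt (InScaledΔ c d (+ suc (J ℕ.+ r) / 1)) (combination shifted)
    shifted-interior d≢0 l l∈L 0≤l-back 0≤l-extra 1≤l-sUnit =
      perturbation⇒interior (J ℕ.+ r) shifted l′ lexPositive lexNonNegative
        (ℤP.≤-reflexive (trans ∑shifted (cong +_ (ℕP.+-comm r J)))) l′∈L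
      where
      -- doubling l compensates the entry −1 of balance at sUnit
      l′ : Fin N → ℤ
      l′ i = + 2 ℤ.* l i ℤ.+ balance i

      l′∈L : InL c d l′
      l′∈L t = begin
        ∑ℤ (λ i → (+ 2 ℤ.* l i ℤ.+ balance i) ℤ.* 𝐚 c d i t)                         ≡⟨ ∑ℤ.∑-cong (λ i → distrib (l i) (balance i) (𝐚 c d i t)) ⟩
        ∑ℤ (λ i → + 2 ℤ.* (l i ℤ.* 𝐚 c d i t) ℤ.+ balance i ℤ.* 𝐚 c d i t)          ≡⟨ ∑ℤ.∑-distrib-+ (λ i → + 2 ℤ.* (l i ℤ.* 𝐚 c d i t)) (λ i → balance i ℤ.* 𝐚 c d i t) ⟩
        ∑ℤ (λ i → + 2 ℤ.* (l i ℤ.* 𝐚 c d i t)) ℤ.+ combination balance t          ≡⟨ cong₂ ℤ._+_ (sym (∑ℤ.*-distribˡ-∑ (+ 2) (λ i → l i ℤ.* 𝐚 c d i t))) (balance∈L t) ⟩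
        + 2 ℤ.* combination l t ℤ.+ + 0                                           ≡⟨ cong (λ x → + 2 ℤ.* x ℤ.+ + 0) (l∈L t) ⟩
        + 0                                                                       ∎
        where
        open ≡-Reasoning
        distrib : ∀ x y a → (+ 2 ℤ.* x ℤ.+ y) ℤ.* a ≡ + 2 ℤ.* (x ℤ.* a) ℤ.+ y ℤ.* a
        distrib = solve-∀

      0≤2l : ∀ {i} → + 0 ℤ.≤ l i → + 0 ℤ.≤ + 2 ℤ.* l i
      0≤2l = 0≤*ℤ {+ 2} (ℤ.+≤+ ℕ.z≤n)

      lexPositive : ∀ u → LexPositive (shifted (unit u)) (l′ (unit u))
      lexPositive u with split (r ℕ.+ J) u
      ... | right k = inj₂ (trans (shifted-≢ (back k) (back≢extra k s) back≢sUnit) (frontIndicator-back k)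
                          , ℤP.+-mono-≤ (0≤2l (0≤l-back k)) (balance-back k (d≢0 k)))
        where
        back≢sUnit : back k ≢ sUnit
        back≢sUnit eq = ↑ˡ≢↑ʳ (s ↑ˡ J) k (sym (↑ˡ-injective r _ _ eq))
      ... | left t with t ≟ᶠ s ↑ˡ J
      ...   | yes refl = inj₂ (shifted-sUnit , subst (λ b → + 1 ℤ.≤ + 2 ℤ.* l sUnit ℤ.+ b) (sym (balance-sCoord s))
                                                 (ℤP.+-monoˡ-≤ -[1+ 0 ] (ℤP.*-monoˡ-≤-nonNeg (+ 2) 1≤l-sUnit)))
      ...   | no t≢s   = inj₁ (ℤP.≤-reflexive (sym (trans (shifted-≢ (front t) (front≢extra t s)
                                 (t≢s ∘ ↑ˡ-injective K t (s ↑ˡ J) ∘ ↑ˡ-injective r _ _)) (frontIndicator-front t))))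

      lexNonNegative : ∀ s′ → LexNonNegative (shifted (extra s′)) (l′ (extra s′))
      lexNonNegative s′ with s′ ≟ᶠ s
      ... | yes refl = inj₁ (ℤP.≤-reflexive (sym shifted-extra))
      ... | no s′≢s  = inj₂ (trans (shifted-≢ (extra s′) (s′≢s ∘ ↑ʳ-injective n s′ s) (front≢extra (s ↑ˡ J) s′ ∘ sym))
                                   (frontIndicator-extra s′)
                            , ℤP.+-mono-≤ (0≤2l (0≤l-extra s′ s′≢s)) (ℤP.≤-trans (ℤ.+≤+ ℕ.z≤n) (ℤP.≤-reflexive (sym (balance-extra s′)))))

    coincide⇒zero-column : (∀ t → combination shifted t ≡ combination frontIndicator t) →
                           (∀ j → c j s ≡ 0) × (∀ k → d k s ≡ 0)
    coincide⇒zero-column y≡x =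
        (λ j → ℤP.+-injective (trans (sym (extraVec-j s j)) (trans (extraVec≡δ (jCoord j)) (δ-≢ (s≢j j)))))
      , (λ k → ℤP.+-injective (ℤP.neg-injective (trans (sym (extraVec-k s k)) (trans (extraVec≡δ (kCoord k)) (δ-≢ (↑ˡ≢↑ʳ (s ↑ˡ J) k))))))
      where
      s≢j : ∀ j → sCoord s ≢ jCoord j
      s≢j j = ↑ˡ≢↑ʳ s j ∘ ↑ˡ-injective K (s ↑ˡ J) (r ↑ʳ j)
      extraVec≡δ : ∀ t → extraVec c d s t ≡ δ (sCoord s) t
      extraVec≡δ t = x+a-b≡x⇒a≡b (combination frontIndicator t) (begin
        combination frontIndicator t ℤ.+ extraVec c d s t ℤ.+ ℤ.- δ (sCoord s) t   ≡⟨ cong₂ (λ x y → combination frontIndicator t ℤ.+ x ℤ.+ ℤ.- y)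
                                                                                       (𝐚-extra s t) (𝐚-unit (sCoord s) t) ⟨
        combination frontIndicator t ℤ.+ 𝐚 c d (extra s) t ℤ.+ ℤ.- 𝐚 c d sUnit t   ≡⟨ combination-+δ-δ frontIndicator (extra s) sUnit t ⟨
        combination shifted t                                                     ≡⟨ y≡x t ⟩
        combination frontIndicator t                                              ∎)
        where open ≡-Reasoning

proposition4p3 :
    (r J K : ℕ) → 0 ℕ.< r → 0 ℕ.< J → 0 ℕ.< K →
    (c : Fin J → Fin r → ℕ) → (d : Fin K → Fin r → ℕ) →
    (∀ j → ¬ (∀ s → c j s ≡ 0)) →
    (∀ k → ¬ (∀ s → d k s ≡ 0)) →
    (∀ j k → ¬ (∀ s → c j s ≡ d k s)) →
    (∀ s → (∃ λ j → c j s ≢ 0) ⊎ (∃ λ k → d k s ≢ 0)) →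
    (∀ s → ∑ℕ (λ j → c j s) ≡ ∑ℕ (λ k → d k s)) →
    IsUniqueInteriorLatticePt (InScaledΔ c d (+ (J ℕ.+ r ℕ.+ 1) / 1)) (sumFirstPts c d) →
    ∀ (s : Fin r) → MinimalNSupp c d (dim r J K ↑ʳ s) (v0 {r} {J} {K})
proposition4p3 r J K _ _ _ c d _ d≢0 _ column≢0 _ unique s (l , l∈L , shrinks , i , i∈ , i∉) =
  [ (λ (j , c≢0) → c≢0 (proj₁ zero-column j)) , (λ (k , d≢0) → d≢0 (proj₂ zero-column k)) ]′ (column≢0 s)
  where
  open Configuration c d
  open Minimality c d
  open Shifted s

  nonNeg : ∀ j → j ≢ extra s → v j ≡ + 0 → + 0 ℤ.≤ l j
  nonNeg = shrinking⇒nonNeg s l shrinks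

  nonNeg-extra : ∀ s′ → s′ ≢ s → + 0 ℤ.≤ l (extra s′)
  nonNeg-extra s′ s′≢s = nonNeg (extra s′) (s′≢s ∘ ↑ʳ-injective n s′ s) (v0-extra s′)

  l-extra<0 : l (extra s) ℤ.< + 0
  l-extra<0 = extra-negative s l l∈L nonNeg-extra (dropped⇒front s l i i∈ i∉)

  y-interior : IsInteriorLatticePt (InScaledΔ c d (+ suc (J ℕ.+ r) / 1)) (combination shifted)
  y-interior = shifted-interior d≢0 l l∈L (λ k → nonNeg (back k) (back≢extra k s) (v0-back k)) nonNeg-extra
                 (sUnit-positive s l l∈L l-extra<0)

  unique′ : IsUniqueInteriorLatticePt (InScaledΔ c d (+ suc (J ℕ.+ r) / 1)) (sumFirstPts c d)
  unique′ = subst (λ m → IsUniqueInteriorLatticePt (InScaledΔ c d (+ m / 1)) (sumFirstPts c d)) (ℕP.+-comm (J ℕ.+ r) 1) unique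

  zero-column : (∀ j → c j s ≡ 0) × (∀ k → d k s ≡ 0)
  zero-column = coincide⇒zero-column (λ t →
    trans (proj₂ unique′ (combination shifted) y-interior t)
          (sym (proj₂ unique′ (combination frontIndicator) (frontSum-interior d≢0) t)))
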